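{- Assume the setting below. Let $Y\subseteq E$ be an independent set with $|Y|\le\ell$. Then every mapping $\psi:Y\to\Gamma$ is robustly consistent.
   Context: Setting: $\mathcal E$ is a family of $2$-connected $3$-regular expander graphs (infinite family with positive infimum of the expansion ratio $\min_{0<|W|\le|V|/2}|\partial(W)|/|W|$), and $c>0$ is a constant such that for every $G\in\mathcal E$ and every $X\subseteq E(G)$ there is $\hat X\supseteq X$ with $|\hat X|\le c|X|$ such that $E(G)\setminus\hat X$ is empty or the edge set of a $2$-connected subgraph of $G$. Fix $G=(V,E)\in\mathcal E$, $n=|V|$, $m=|E|$, $\ell=\lfloor (m-1)/(3c)\rfloor$. For $X\subseteq E$, $\mathrm{cl}(X)$ is the set of edges $x\in E$ such that no cycle of $G$ with edge set contained in $E\setminus X$ contains $x$. A set $I\subseteq E$ is independent if $x\notin\mathrm{cl}(I\setminus\{x\})$ for all $x\in I$. Let $H$ be an orientation of $G$, $\Gamma$ a finite Abelian group, $\sigma:V\to\Gamma$; edges, their orientations, and variables $x_e$ are identified. For $W\subseteq V$, $\partial(W)$ is the set of edges between $W$ and $V\setminus W$, $\partial_\pm(W)$ the edges of $H$ with tail (+) resp. head (−) in $W$ and other end outside $W$, $\sigma(W)=\sum_{w\in W}\sigma(w)$, and $C(W)$ is the constraint $\sum_{e\in\partial_+(W)}x_e-\sum_{e\in\partial_-(W)}x_e=\sigma(W)$ in $\Gamma$. A partial mapping $\psi$ from $E$ to $\Gamma$ is $k$-consistent if it satisfies $C(W)$ for every $W\subseteq V$ with $|W|\le k$ and $\partial(W)\subseteq\mathrm{dom}(\psi)$;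 it is robustly consistent if it is $n/3$-consistent.
   Formalization: The constant c is taken to be a positive rational number. -}

module Defs where

open import Data.Nat as ℕ using (ℕ; zero; suc; _≤_; _<_; _*_)
open import Data.Integer as ℤ using (ℤ; +_)
open import Data.Rational as ℚ using (ℚ; Positive; _÷_; floor)
open import Data.Rational.Properties using (pos⇒nonZero)
open import Data.Fin using (Fin; zero; suc)
open import Data.Fin.Subset using (Subset; _∈_; _∉_; _⊆_; ∣_∣; ⊤; _─_; ⁅_⁆; outside; inside)
open import Data.Vec using (lookup)
open import Data.Bool using (Bool; true; false; if_then_else_; _∧_; not)
open import Data.Product using (Σ; _×_; _,_; ∃; ∃-syntax)
open import Data.Sum using (_⊎_)
open import Data.Maybe using (Maybe; just; nothing)
open import Relation.Nullary using (¬_; does)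
open import Relation.Binary.PropositionalEquality using (_≡_; _≢_)
open import Function.Definitions using (Injective)
open import Algebra.Bundles using (AbelianGroup)
open import Level using (Level)

-- Finite (multi)graphs: vertices Fin n, edges Fin m, each edge has two
-- (unordered) ends end₁, end₂.

record Graph : Set where
  field
    n    : ℕ
    m    : ℕ
    end₁ : Fin m → Fin n
    end₂ : Fin m → Fin n
open Graph public

Joins : (G : Graph) → Fin (m G) → Fin (n G) → Fin (n G) → Set
Joins G e a b = (end₁ G e ≡ a × end₂ G e ≡ b) ⊎ (end₁ G e ≡ b × end₂ G e ≡ a)

Simple : Graph → Set
Simple G = (∀ e → end₁ G e ≢ end₂ G e)
         × (∀ e f → Joins G f (end₁ G e) (end₂ G e) → e ≡ f)

degree : (G : Graph) → Fin (n G) → ℕ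
degree G v = ∣ incid ∣
  where
  incid : Subset (m G)
  incid = Data.Vec.tabulate λ e →
    if (does (end₁ G e Data.Fin.≟ v) Data.Bool.∨ does (end₂ G e Data.Fin.≟ v))
    then inside else outside

Cubic : Graph → Set
Cubic G = ∀ v → degree G v ≡ 3

Touches : (G : Graph) → Subset (m G) → Fin (n G) → Set
Touches G F v = ∃[ e ] (e ∈ F × (end₁ G e ≡ v ⊎ end₂ G e ≡ v))

-- Reach G F z u v : there is a walk from u to v using only edges of F
-- and (if z = just z₀) never visiting the vertex z₀.
data Reach (G : Graph) (F : Subset (m G)) (z : Maybe (Fin (n G)))
           : Fin (n G) → Fin (n G) → Set where
  here : ∀ {u} → Reach G F z u u
  step : ∀ {u w v} (e : Fin (m G)) → e ∈ F → Joins G e u w →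
         (∀ z₀ → z ≡ just z₀ → w ≢ z₀) → Reach G F z w v → Reach G F z u v

-- The subgraph of G with edge set F (vertices: the ends of edges of F)
-- is 2-connected: it has at least 3 vertices, is connected, and stays
-- connected after deleting any single vertex.
TwoConnectedEdgeSet : (G : Graph) → Subset (m G) → Set
TwoConnectedEdgeSet G F =
    (∃[ a ] ∃[ b ] ∃[ c ] (Touches G F a × Touches G F b × Touches G F c
                           × a ≢ b × b ≢ c × a ≢ c))
  × (∀ u v → Touches G F u → Touches G F v → Reach G F nothing u v)
  × (∀ z u v → Touches G F u → Touches G F v → u ≢ z → v ≢ z →
       Reach G F (just z) u v)

-- G itself is 2-connected (every vertex of a cubic graph is an end of an edge)
TwoConnected : Graph → Set
TwoConnected G = TwoConnectedEdgeSet G ⊤ × (∀ v → Touches G ⊤ v)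

Cut : (G : Graph) → Subset (n G) → Subset (m G)
Cut G W = Data.Vec.tabulate λ e →
  if lookup W (end₁ G e) Data.Bool.xor lookup W (end₂ G e) then inside else outside

IsExpanderFamily : (ℕ → Graph) → Set
IsExpanderFamily F =
    (∀ i → Simple (F i) × Cubic (F i) × TwoConnected (F i))
  × (∀ N → ∃[ i ] N ≤ n (F i))                       -- infinite family
  × (∃[ h ] (Positive h × (∀ i (W : Subset (n (F i))) →
        0 < ∣ W ∣ → 2 * ∣ W ∣ ≤ n (F i) →
        h ℚ.* (+ ∣ W ∣ ℚ./ 1) ℚ.≤ (+ ∣ Cut (F i) W ∣ ℚ./ 1))))

ClosureProperty : ℚ → Graph → Set
ClosureProperty c G = ∀ (X : Subset (m G)) → ∃[ X̂ ] (X ⊆ X̂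
  × (+ ∣ X̂ ∣ ℚ./ 1) ℚ.≤ c ℚ.* (+ ∣ X ∣ ℚ./ 1)
  × ((∀ e → e ∈ X̂) ⊎ TwoConnectedEdgeSet G (⊤ ─ X̂)))

-- a cycle of length k ≥ 3: distinct vertices vs 0..k-1, with edge es i
-- joining vs i and vs (i+1 mod k)
nextFin : ∀ {k} → Fin k → Fin k
nextFin {suc k} i with Data.Fin.toℕ i ℕ.<? k
... | Relation.Nullary.yes p = Data.Fin.fromℕ< (ℕ.s≤s p)
... | Relation.Nullary.no _ = zero

record Cycle (G : Graph) : Set where
  field
    len    : ℕ
    len≥3  : 3 ≤ len
    vs     : Fin len → Fin (n G)
    es     : Fin len → Fin (m G)
    vsInj  : Injective _≡_ _≡_ vs
    joins  : ∀ i → Joins G (es i) (vs i) (vs (nextFin i))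
open Cycle public

InCl : (G : Graph) → Subset (m G) → Fin (m G) → Set
InCl G X x = ¬ (Σ (Cycle G) λ C → (∀ i → es C i ∉ X) × (∃[ i ] es C i ≡ x))

Independent : (G : Graph) → Subset (m G) → Set
Independent G I = ∀ x → x ∈ I → ¬ InCl G (I ─ ⁅ x ⁆) x

ell : (G : Graph) (c : ℚ) → .{{Positive c}} → ℤ
ell G c {{p}} = floor (((+ m G ℤ.- + 1) ℚ./ 3) ÷ c)
  where instance _ = pos⇒nonZero c {{p}}

module _ {a ℓ' : Level} (Γ : AbelianGroup a ℓ') where
  open AbelianGroup Γ

  FiniteGroup : Set (a Level.⊔ ℓ')
  FiniteGroup = ∃[ k ] Σ (Fin k → Carrier) λ f → ∀ g → ∃[ i ] f i ≈ g

  sumFin : ∀ {k} → (Fin k → Carrier) → Carrier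
  sumFin {zero}  f = ε
  sumFin {suc k} f = f zero ∙ sumFin (λ i → f (suc i))

  -- orientation H given by flip : Fin m → Bool ;
  -- tail e = end₁ e, head e = end₂ e if flip e = false, reversed otherwise.
  module _ (G : Graph) (flip : Fin (m G) → Bool) where
    tailH headH : Fin (m G) → Fin (n G)
    tailH e = if flip e then end₂ G e else end₁ G e
    headH e = if flip e then end₁ G e else end₂ G e

    Constraint : (σ : Fin (n G) → Carrier) (ψ : Fin (m G) → Carrier) →
                 Subset (n G) → Set ℓ'
    Constraint σ ψ W =
      sumFin (λ e → if lookup W (tailH e) ∧ not (lookup W (headH e)) then ψ e else ε)
      ∙ (sumFin (λ e → if lookup W (headH e) ∧ not (lookup W (tailH e)) then ψ e else ε)) ⁻¹
      ≈ sumFin (λ v → if lookup W v then σ v else ε)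

    -- the partial map ψ with domain Y is robustly consistent:
    -- C(W) holds for all W with |W| ≤ n/3 and ∂(W) ⊆ Y
    RobustlyConsistent : (σ : Fin (n G) → Carrier) (Y : Subset (m G))
                         (ψ : Fin (m G) → Carrier) → Set ℓ'
    RobustlyConsistent σ Y ψ = ∀ (W : Subset (n G)) →
      3 * ∣ W ∣ ≤ n G → Cut G W ⊆ Y → Constraint σ ψ W

-- Only the connectivity of G and the independence of Y matter. An edge e of an independent set Y lies on a cycle meeting Y only in e, while a
-- cycle cannot cross a cut exactly once; so a cut ∂(W) contained in Y is empty. By connectivity W is then either
-- empty, where C(W) reads 0 = 0, or all of V, which |W| ≤ n/3 excludes.
module Submission where

open import Defs
open import Level using (Level)
open import Data.Nat using (ℕ)
open import Data.Bool using (Bool)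
open import Data.Integer using (+_) renaming (_≤_ to _≤ℤ_)
open import Data.Rational using (ℚ; Positive)
open import Data.Fin using (Fin)
open import Data.Fin.Subset using (Subset; ∣_∣)
open import Data.Product using (∃-syntax)
open import Relation.Binary.PropositionalEquality using (_≡_)
open import Algebra.Bundles using (AbelianGroup)

open import Data.Nat as ℕ using (zero; suc; s≤s; z<s; s<s)
open import Data.Nat.Properties as ℕ using ()
open import Data.Fin as Fin using (zero; suc; toℕ; fromℕ; inject₁; _<_)
open import Data.Fin.Properties
  using (toℕ-injective; toℕ-fromℕ; toℕ-fromℕ<; toℕ-inject₁; toℕ<n; fromℕ≢inject₁; inject₁-injective; <⇒≢)
open import Data.Product using (Σ; _×_; _,_; proj₂)
open import Data.Bool as B using (true; false; _xor_; if_then_else_)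
open import Data.Bool.Properties using (xor-same; xor-comm; ¬-not)
open import Data.Fin.Subset using (_∈_; _∉_; _⊆_; _─_; ⁅_⁆; ⊤; Empty; Nonempty)
open import Data.Fin.Subset.Properties using (_∈?_; x∈p∧x∉q⇒x∈p─q; x∈⁅y⁆⇒x≡y; nonempty?; ∣⊤∣≡n; p⊆q⇒∣p∣≤∣q∣)
open import Data.Vec using (lookup)
open import Data.Vec.Properties using (lookup∘tabulate; []=⇒lookup; lookup⇒[]=)
open import Data.Maybe using (nothing)
open import Data.Sum using (_⊎_; inj₁; inj₂)
open import Function using (_∘_)
open import Function.Definitions using (Injective)
open import Relation.Nullary using (¬_; yes; no; contradiction)
open import Relation.Nullary.Decidable using (decidable-stable)
open import Relation.Binary.PropositionalEquality using (_≢_; refl; sym; trans; cong; subst; module ≡-Reasoning)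

fromℕ-or-inject₁ : ∀ {k} (i : Fin (suc k)) → i ≡ fromℕ k ⊎ ∃[ s ] i ≡ inject₁ s
fromℕ-or-inject₁ {zero}  zero    = inj₁ refl
fromℕ-or-inject₁ {suc k} zero    = inj₂ (zero , refl)
fromℕ-or-inject₁ {suc k} (suc i) with fromℕ-or-inject₁ i
... | inj₁ i≡last     = inj₁ (cong suc i≡last)
... | inj₂ (s , i≡s) = inj₂ (suc s , cong suc i≡s)

nextFin-inject₁ : ∀ {k} (s : Fin k) → nextFin (inject₁ s) ≡ suc s
nextFin-inject₁ {k} s with toℕ (inject₁ s) ℕ.<? k
... | yes s<k = toℕ-injective (trans (toℕ-fromℕ< (s≤s s<k)) (cong suc (toℕ-inject₁ s)))
... | no  s≮k = contradiction (subst (ℕ._< k) (sym (toℕ-inject₁ s)) (toℕ<n s)) s≮k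

nextFin-fromℕ : ∀ k → nextFin (fromℕ k) ≡ zero
nextFin-fromℕ k with toℕ (fromℕ k) ℕ.<? k
... | yes k<k = contradiction (subst (ℕ._< k) (toℕ-fromℕ k) k<k) (ℕ.n≮n k)
... | no  _   = refl

nextFin²≢id : ∀ {L} → 3 ℕ.≤ L → (i : Fin L) → nextFin (nextFin i) ≢ i
nextFin²≢id {suc (suc (suc k))} (s≤s (s≤s (s≤s _))) i nn≡i with fromℕ-or-inject₁ i
... | inj₁ refl = contradiction (trans (sym nn≡1) nn≡i) λ ()
  where
  nn≡1 : nextFin (nextFin (fromℕ (suc (suc k)))) ≡ suc zero
  nn≡1 = trans (cong nextFin (nextFin-fromℕ (suc (suc k)))) (nextFin-inject₁ zero)
... | inj₂ (s , refl) with fromℕ-or-inject₁ (suc s)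
...   | inj₁ s+1≡last = contradiction (trans (sym s≡0) s≡k+1) λ ()
  where
  s≡0 : toℕ s ≡ 0
  s≡0 = begin
    toℕ s                                  ≡⟨ toℕ-inject₁ s ⟨
    toℕ (inject₁ s)                        ≡⟨ cong toℕ nn≡i ⟨
    toℕ (nextFin (nextFin (inject₁ s)))    ≡⟨ cong (toℕ ∘ nextFin) (nextFin-inject₁ s) ⟩
    toℕ (nextFin (suc s))                  ≡⟨ cong (toℕ ∘ nextFin) s+1≡last ⟩
    toℕ (nextFin (fromℕ (suc (suc k))))    ≡⟨ cong toℕ (nextFin-fromℕ (suc (suc k))) ⟩
    0                                      ∎
    where open ≡-Reasoning
  s≡k+1 : toℕ s ≡ suc k
  s≡k+1 = ℕ.suc-injective (trans (cong toℕ s+1≡last) (toℕ-fromℕ (suc (suc k))))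
...   | inj₂ (t , s+1≡t) =
  ℕ.<-irrefl (sym s+2≡s) (ℕ.<-trans (ℕ.n<1+n (toℕ s)) (ℕ.n<1+n (suc (toℕ s))))
  where
  s+2≡s : suc (suc (toℕ s)) ≡ toℕ s
  s+2≡s = begin
    suc (suc (toℕ s))                      ≡⟨ cong suc (trans (cong toℕ s+1≡t) (toℕ-inject₁ t)) ⟩
    suc (toℕ t)                            ≡⟨ cong toℕ (nextFin-inject₁ t) ⟨
    toℕ (nextFin (inject₁ t))              ≡⟨ cong (toℕ ∘ nextFin) s+1≡t ⟨
    toℕ (nextFin (suc s))                  ≡⟨ cong (toℕ ∘ nextFin) (nextFin-inject₁ s) ⟨
    toℕ (nextFin (nextFin (inject₁ s)))    ≡⟨ cong toℕ nn≡i ⟩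
    toℕ (inject₁ s)                        ≡⟨ toℕ-inject₁ s ⟩
    toℕ s                                  ∎
    where open ≡-Reasoning

module _ {a} {A : Set a} where

  constant-on-prefix : ∀ {k} (b : Fin (suc k) → A) (i : Fin (suc k)) →
    (∀ t → inject₁ t < i → b (inject₁ t) ≡ b (suc t)) → b zero ≡ b i
  constant-on-prefix         b zero    _ = refl
  constant-on-prefix {suc k} b (suc i) steps =
    trans (steps zero z<s) (constant-on-prefix (b ∘ suc) i (λ t t<i → steps (suc t) (s<s t<i)))

  constant-on-suffix : ∀ {k} (b : Fin (suc k) → A) (s : Fin k) →
    (∀ t → s < t → b (inject₁ t) ≡ b (suc t)) → b (suc s) ≡ b (fromℕ k)
  constant-on-suffix {suc k} b zero    steps =
    constant-on-prefix (b ∘ suc) (fromℕ k) (λ t _ → steps (suc t) z<s)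
  constant-on-suffix {suc k} b (suc s) steps =
    constant-on-suffix (b ∘ suc) s (λ t s<t → steps (suc t) (s<s s<t))

  inject₁-steps : ∀ {k} (b : Fin (suc k) → A) {i₀} → (∀ j → j ≢ i₀ → b j ≡ b (nextFin j)) →
    ∀ t → inject₁ t ≢ i₀ → b (inject₁ t) ≡ b (suc t)
  inject₁-steps b steps t t≢i₀ = trans (steps (inject₁ t) t≢i₀) (cong b (nextFin-inject₁ t))

  ≡-nextFin-except⇒≡-nextFin : ∀ {L} (b : Fin L → A) (i₀ : Fin L) →
    (∀ j → j ≢ i₀ → b j ≡ b (nextFin j)) → b i₀ ≡ b (nextFin i₀)
  ≡-nextFin-except⇒≡-nextFin {suc k} b i₀ steps with fromℕ-or-inject₁ i₀
  ... | inj₁ refl = begin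
    b (fromℕ k)            ≡⟨ constant-on-prefix b (fromℕ k) (λ t _ →
                                inject₁-steps b steps t (fromℕ≢inject₁ ∘ sym)) ⟨
    b zero                 ≡⟨ cong b (nextFin-fromℕ k) ⟨
    b (nextFin (fromℕ k))  ∎
    where open ≡-Reasoning
  ... | inj₂ (s , refl) = begin
    b (inject₁ s)            ≡⟨ constant-on-prefix b (inject₁ s) (λ t t<s →
                                  inject₁-steps b steps t (<⇒≢ t<s)) ⟨
    b zero                   ≡⟨ cong b (nextFin-fromℕ k) ⟨
    b (nextFin (fromℕ k))    ≡⟨ steps (fromℕ k) fromℕ≢inject₁ ⟨
    b (fromℕ k)              ≡⟨ constant-on-suffix b s (λ t s<t →
                                  inject₁-steps b steps t (<⇒≢ s<t ∘ sym ∘ inject₁-injective)) ⟨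
    b (suc s)                ≡⟨ cong b (nextFin-inject₁ s) ⟨
    b (nextFin (inject₁ s))  ∎
    where open ≡-Reasoning

module _ {G : Graph} (C : Cycle G) where

  es-injective : Injective _≡_ _≡_ (es C)
  es-injective {j} {i} esj≡esi =
    same-ends (subst (λ e → Joins G e _ _) esj≡esi (joins C j)) (joins C i)
    where
    reversed : j ≡ nextFin i → nextFin j ≡ i → j ≡ i
    reversed j≡i+1 j+1≡i =
      contradiction (trans (cong nextFin (sym j≡i+1)) j+1≡i) (nextFin²≢id (len≥3 C) i)
    same-ends : Joins G (es C i) (vs C j) (vs C (nextFin j)) →
                Joins G (es C i) (vs C i) (vs C (nextFin i)) → j ≡ i
    same-ends (inj₁ (p₁ , p₂)) (inj₁ (q₁ , q₂)) = vsInj C (trans (sym p₁) q₁)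
    same-ends (inj₁ (p₁ , p₂)) (inj₂ (q₁ , q₂)) =
      reversed (vsInj C (trans (sym p₁) q₁)) (vsInj C (trans (sym p₂) q₂))
    same-ends (inj₂ (p₁ , p₂)) (inj₁ (q₁ , q₂)) =
      reversed (vsInj C (trans (sym p₂) q₂)) (vsInj C (trans (sym p₁) q₁))
    same-ends (inj₂ (p₁ , p₂)) (inj₂ (q₁ , q₂)) = vsInj C (trans (sym p₂) q₂)

if-then-true-else-false : ∀ b → (if b then true else false) ≡ b
if-then-true-else-false true  = refl
if-then-true-else-false false = refl

≢⇒xor≡true : ∀ {x y} → x ≢ y → x xor y ≡ true
≢⇒xor≡true {true}  {true}  x≢y = contradiction refl x≢y
≢⇒xor≡true {true}  {false} _   = refl
≢⇒xor≡true {false} {true}  _   = refl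
≢⇒xor≡true {false} {false} x≢y = contradiction refl x≢y

xor≡true⇒≢ : ∀ {x y} → x xor y ≡ true → x ≢ y
xor≡true⇒≢ {x} x⊕x≡true refl = contradiction (trans (sym (xor-same x)) x⊕x≡true) λ ()

∉⇒lookup≡false : ∀ {k} {x : Fin k} {p : Subset k} → x ∉ p → lookup p x ≡ false
∉⇒lookup≡false {x = x} {p} x∉p = ¬-not (x∉p ∘ lookup⇒[]= x p)

x∈p∧x∉p─⁅y⁆⇒x≡y : ∀ {k} {x y : Fin k} {p : Subset k} → x ∈ p → x ∉ p ─ ⁅ y ⁆ → x ≡ y
x∈p∧x∉p─⁅y⁆⇒x≡y {x = x} {y} x∈p x∉p─y =
  decidable-stable (x Fin.≟ y) λ x≢y → x∉p─y (x∈p∧x∉q⇒x∈p─q x∈p (x≢y ∘ x∈⁅y⁆⇒x≡y y))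

module _ (G : Graph) (W : Subset (n G)) where

  lookup-Cut : ∀ {e a b} → Joins G e a b → lookup (Cut G W) e ≡ lookup W a xor lookup W b
  lookup-Cut {e} ends =
    trans (lookup∘tabulate _ e) (trans (if-then-true-else-false _) (xor-of-ends ends))
    where
    xor-of-ends : ∀ {a b} → Joins G e a b →
      lookup W (end₁ G e) xor lookup W (end₂ G e) ≡ lookup W a xor lookup W b
    xor-of-ends (inj₁ (refl , refl)) = refl
    xor-of-ends (inj₂ (refl , refl)) = xor-comm (lookup W (end₁ G e)) (lookup W (end₂ G e))

  Joins⇒∈Cut : ∀ {e a b} → Joins G e a b → lookup W a ≢ lookup W b → e ∈ Cut G W
  Joins⇒∈Cut {e} ends a≢b = lookup⇒[]= e (Cut G W) (trans (lookup-Cut ends) (≢⇒xor≡true a≢b))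

  Joins∧∈Cut⇒≢ : ∀ {e a b} → Joins G e a b → e ∈ Cut G W → lookup W a ≢ lookup W b
  Joins∧∈Cut⇒≢ ends e∈Cut = xor≡true⇒≢ (trans (sym (lookup-Cut ends)) ([]=⇒lookup e∈Cut))

  Reach⇒∃∈Cut : ∀ {F z u v} → Reach G F z u v → u ∈ W → v ∉ W → ∃[ e ] (e ∈ F × e ∈ Cut G W)
  Reach⇒∃∈Cut here u∈W u∉W = contradiction u∈W u∉W
  Reach⇒∃∈Cut (step {w = w} e e∈F ends _ walk) u∈W v∉W with w ∈? W
  ... | yes w∈W = Reach⇒∃∈Cut walk w∈W v∉W
  ... | no  w∉W = e , e∈F , Joins⇒∈Cut ends λ u≡w →
    w∉W (lookup⇒[]= w W (trans (sym u≡w) ([]=⇒lookup u∈W)))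

  cycle-meets-Cut-twice : (C : Cycle G) (i₀ : Fin (len C)) → es C i₀ ∈ Cut G W →
    ¬ (∀ j → j ≢ i₀ → es C j ∉ Cut G W)
  cycle-meets-Cut-twice C i₀ i₀∈Cut only-i₀ =
    Joins∧∈Cut⇒≢ (joins C i₀) i₀∈Cut (≡-nextFin-except⇒≡-nextFin side i₀ side-kept)
    where
    side : Fin (len C) → Bool
    side j = lookup W (vs C j)
    side-kept : ∀ j → j ≢ i₀ → side j ≡ side (nextFin j)
    side-kept j j≢i₀ = decidable-stable (side j B.≟ side (nextFin j))
      (only-i₀ j j≢i₀ ∘ Joins⇒∈Cut (joins C j))

  connected∧Empty-Cut⇒⊤⊆ : (∀ u v → Reach G ⊤ nothing u v) → Empty (Cut G W) → Nonempty W →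
    ⊤ ⊆ W
  connected∧Empty-Cut⇒⊤⊆ connected no-cut (v , v∈W) {u} _ with u ∈? W
  ... | yes u∈W = u∈W
  ... | no  u∉W with Reach⇒∃∈Cut (connected v u) v∈W u∉W
  ...   | e , _ , e∈Cut = contradiction (e , e∈Cut) no-cut

Independent∧Cut⊆⇒Empty-Cut : ∀ {G : Graph} {Y : Subset (m G)} {W : Subset (n G)} →
  Independent G Y → Cut G W ⊆ Y → Empty (Cut G W)
Independent∧Cut⊆⇒Empty-Cut {G} {Y} {W} independent ∂W⊆Y (e , e∈∂W) =
  independent e (∂W⊆Y e∈∂W) cycle-through-e-is-impossible
  where
  cycle-through-e-is-impossible :
    ¬ Σ (Cycle G) λ C → (∀ i → es C i ∉ Y ─ ⁅ e ⁆) × (∃[ i ] es C i ≡ e)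
  cycle-through-e-is-impossible (C , avoids , i₀ , esi₀≡e) =
    cycle-meets-Cut-twice G W C i₀ (subst (_∈ Cut G W) (sym esi₀≡e) e∈∂W) λ j j≢i₀ esj∈∂W →
      j≢i₀ (es-injective C (trans (x∈p∧x∉p─⁅y⁆⇒x≡y (∂W⊆Y esj∈∂W) (avoids j)) (sym esi₀≡e)))

module _ {a ℓ' : Level} (Γ : AbelianGroup a ℓ') where
  open AbelianGroup Γ using (Carrier; _≈_; ε; ∙-cong; ⁻¹-cong; identityˡ; inverseʳ; reflexive)
    renaming (refl to ≈-refl; sym to ≈-sym; trans to ≈-trans)

  sumFin-ε : ∀ {k} (f : Fin k → Carrier) → (∀ i → f i ≈ ε) → sumFin Γ f ≈ ε
  sumFin-ε {zero}  f f≈ε = ≈-refl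
  sumFin-ε {suc k} f f≈ε =
    ≈-trans (∙-cong (f≈ε zero) (sumFin-ε (f ∘ suc) (f≈ε ∘ suc))) (identityˡ ε)

  Empty⇒Constraint : (G : Graph) (flip : Fin (m G) → Bool) (σ : Fin (n G) → Carrier)
    (ψ : Fin (m G) → Carrier) (W : Subset (n G)) → Empty W → Constraint Γ G flip σ ψ W
  Empty⇒Constraint G flip σ ψ W W-empty =
    ≈-trans (∙-cong (sumFin-ε _ (leaving-ε (tailH Γ G flip))) (⁻¹-cong (sumFin-ε _ (leaving-ε (headH Γ G flip)))))
      (≈-trans (inverseʳ ε) (≈-sym (sumFin-ε _ inside-ε)))
    where
    outside : ∀ v → lookup W v ≡ false
    outside v = ∉⇒lookup≡false (W-empty ∘ (v ,_))
    leaving-ε : ∀ (end : Fin (m G) → Fin (n G)) {y : Fin (m G) → Bool} e →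
      (if lookup W (end e) B.∧ y e then ψ e else ε) ≈ ε
    leaving-ε end {y} e = reflexive (cong (λ b → if b B.∧ y e then ψ e else ε) (outside (end e)))
    inside-ε : ∀ v → (if lookup W v then σ v else ε) ≈ ε
    inside-ε v = reflexive (cong (λ b → if b then σ v else ε) (outside v))

n≤m⇒3*m≰n : ∀ {n m} → Fin n → n ℕ.≤ m → ¬ (3 ℕ.* m ℕ.≤ n)
n≤m⇒3*m≰n {suc n} {suc m} _ n≤m 3m≤n = contradiction 3≤1 λ { (s≤s ()) }
  where
  3m≤1m : 3 ℕ.* suc m ℕ.≤ 1 ℕ.* suc m
  3m≤1m = ℕ.≤-trans 3m≤n (ℕ.≤-trans n≤m (ℕ.≤-reflexive (sym (ℕ.*-identityˡ (suc m)))))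
  3≤1 : 3 ℕ.≤ 1
  3≤1 = ℕ.*-cancelʳ-≤ 3 1 (suc m) 3m≤1m

TwoConnected⇒connected : ∀ {G} → TwoConnected G → ∀ u v → Reach G ⊤ nothing u v
TwoConnected⇒connected ((_ , connected , _) , all-touched) u v =
  connected u v (all-touched u) (all-touched v)

mainTheorem13 : (F : ℕ → Graph) → IsExpanderFamily F →
    (c : ℚ) → .{{_ : Positive c}} → (∀ i → ClosureProperty c (F i)) →
    (G : Graph) → (∃[ i ] F i ≡ G) →
    {a ℓ' : Level} (Γ : AbelianGroup a ℓ') → FiniteGroup Γ →
    (flip : Fin (m G) → Bool) → (σ : Fin (n G) → AbelianGroup.Carrier Γ) →
    (Y : Subset (m G)) → Independent G Y → + ∣ Y ∣ ≤ℤ ell G c →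
    (ψ : Fin (m G) → AbelianGroup.Carrier Γ) →
    RobustlyConsistent Γ G flip σ Y ψ
mainTheorem13 F (family , _) c _ .(F i) (i , refl) Γ _ flip σ Y independent _ ψ W 3∣W∣≤n ∂W⊆Y
  with nonempty? W
... | no  W-empty = Empty⇒Constraint Γ (F i) flip σ ψ W W-empty
... | yes (v , v∈W) = contradiction 3∣W∣≤n (n≤m⇒3*m≰n v n≤∣W∣)
  where
  ⊤⊆W : ⊤ ⊆ W
  ⊤⊆W = connected∧Empty-Cut⇒⊤⊆ (F i) W (TwoConnected⇒connected (proj₂ (proj₂ (family i))))
    (Independent∧Cut⊆⇒Empty-Cut {W = W} independent ∂W⊆Y) (v , v∈W)
  n≤∣W∣ : n (F i) ℕ.≤ ∣ W ∣
  n≤∣W∣ = subst (ℕ._≤ ∣ W ∣) (∣⊤∣≡n (n (F i))) (p⊆q⇒∣p∣≤∣q∣ ⊤⊆W)
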